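{- Let $N\ge0$, $k\ge1$, $X=\{0,\ldots,N\}^k$, and let $f$ be a feasibility function on $X$. In a run of $\textsc{ParetoEnumerate}$ on $f$ (including the calls to $f$ made inside $\textsc{SearchParetoPoint}$), once a call to $f$ at some point $\vec x$ has returned $\mathbf{true}$, the algorithm never afterwards calls $f$ at any point $\vec y$ with $\vec x\leq_k\vec y$.
   Context: $X$ is ordered componentwise: $\vec x\leq_k\vec x'$ iff $x_i\le x'_i$ for all $i$. A feasibility function is a monotone $f:X\to\{\mathbf{true},\mathbf{false}\}$ (if $f(\vec x)=\mathbf{true}$ and $\vec x\leq_k\vec x'$ then $f(\vec x')=\mathbf{true}$). $\textsc{SearchParetoPoint}(\vec x)$: for $i=1,\ldots,k$: $\mathit{max}\gets x_i+1$, $\mathit{min}\gets0$; while $\mathit{max}-\mathit{min}>1$: $\mathit{mid}\gets\mathit{min}+\lfloor(\mathit{max}-\mathit{min}-1)/2\rfloor$, $x_i\gets\mathit{mid}$, if $f(\vec x)=\mathbf{true}$ then $\mathit{max}\gets\mathit{mid}+1$ else $\mathit{min}\gets\mathit{mid}+1$; then $x_i\gets\mathit{min}$. Return $\vec x$. $\textsc{RemoveDominatingElements}(S')$ returns the set of those $\vec x\in S'$ for which there is no $\vec y\in S'$ with $\vec x\leq_k\vec y$ and $\vec x\neq\vec y$. $\textsc{ParetoEnumerate}$: initialize $S\gets\{(N,\ldots,N)\}$, $P\gets\emptyset$. Main loop: while $S\neq\emptyset$: pick (without removing) some $\vec x\in S$; if $f(\vec x)=\mathbf{true}$ then: $\vec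 x\gets\textsc{SearchParetoPoint}(\vec x)$; $P\gets P\cup\{\vec x\}$; $S'\gets\emptyset$; for each $\vec y\in S$: if not $\vec x\leq_k\vec y$, add $\vec y$ to $S'$; otherwise, for each $i\in\{1,\ldots,k\}$ with $x_i>0$ add $(y_1,\ldots,y_{i-1},x_i-1,y_{i+1},\ldots,y_k)$ to $S'$; then $S\gets\textsc{RemoveDominatingElements}(S')$. Otherwise set $S\gets S\setminus\{\vec x\}$. When the loop ends, return $P$. -}

module Defs where

open import Data.Bool using (Bool; true; false; if_then_else_; not; _∧_)
open import Data.Nat using (ℕ; zero; suc; _+_; _∸_; _≤_; _<_; ⌊_/2⌋)
import Data.Nat as ℕ
open import Data.Fin using (Fin)
open import Data.List using (List; []; _∷_; _++_; concatMap; allFin; filterᵇ)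
open import Data.Bool.ListAction using (any)
open import Data.Vec using (Vec; lookup; _[_]≔_; replicate)
import Data.Vec.Properties as VecP
open import Data.Vec.Relation.Binary.Pointwise.Inductive using (Pointwise; decidable)
open import Data.Vec.Relation.Unary.All using (All)
open import Data.List.Membership.Propositional using (_∈_)
open import Relation.Nullary using (does)
open import Relation.Binary.PropositionalEquality using (_≡_)

Point : ℕ → Set
Point k = Vec ℕ k

InX : ∀ {k} → ℕ → Point k → Set
InX N x = All (_≤ N) x

_≤ₖ_ : ∀ {k} → Point k → Point k → Set
x ≤ₖ y = Pointwise _≤_ x y

_≤ₖᵇ_ : ∀ {k} → Point k → Point k → Bool
x ≤ₖᵇ y = does (decidable ℕ._≤?_ x y)

_≡ᵇ_ : ∀ {k} → Point k → Point k → Bool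
x ≡ᵇ y = does (VecP.≡-dec ℕ._≟_ x y)

Feasibility : ∀ {k} → ℕ → (Point k → Bool) → Set
Feasibility {k} N f = ∀ (x x' : Point k) → InX N x → InX N x' → x ≤ₖ x' →
  f x ≡ true → f x' ≡ true

-- SearchParetoPoint, as a big-step relation that also records the list of
-- points at which f is called (in order).

-- BinSearch f i x min max calls min' : starting with vector x and bounds
-- min, max, the while loop performs the calls `calls` and ends with min = min'.
data BinSearch {k} (f : Point k → Bool) (i : Fin k) :
       Point k → ℕ → ℕ → List (Point k) → ℕ → Set where
  done  : ∀ {x mn mx} → mx ∸ mn ≤ 1 → BinSearch f i x mn mx [] mn
  stepT : ∀ {x mn mx cs r} → 1 < mx ∸ mn →
          f (x [ i ]≔ (mn + ⌊ mx ∸ mn ∸ 1 /2⌋)) ≡ true →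
          BinSearch f i (x [ i ]≔ (mn + ⌊ mx ∸ mn ∸ 1 /2⌋)) mn
                    (suc (mn + ⌊ mx ∸ mn ∸ 1 /2⌋)) cs r →
          BinSearch f i x mn mx ((x [ i ]≔ (mn + ⌊ mx ∸ mn ∸ 1 /2⌋)) ∷ cs) r
  stepF : ∀ {x mn mx cs r} → 1 < mx ∸ mn →
          f (x [ i ]≔ (mn + ⌊ mx ∸ mn ∸ 1 /2⌋)) ≡ false →
          BinSearch f i (x [ i ]≔ (mn + ⌊ mx ∸ mn ∸ 1 /2⌋))
                    (suc (mn + ⌊ mx ∸ mn ∸ 1 /2⌋)) mx cs r →
          BinSearch f i x mn mx ((x [ i ]≔ (mn + ⌊ mx ∸ mn ∸ 1 /2⌋)) ∷ cs) r

data SearchFrom {k} (f : Point k → Bool) :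
       List (Fin k) → Point k → List (Point k) → Point k → Set where
  nil  : ∀ {x} → SearchFrom f [] x [] x
  cons : ∀ {i is x cs m cs' y} →
         BinSearch f i x 0 (suc (lookup x i)) cs m →
         SearchFrom f is (x [ i ]≔ m) cs' y →
         SearchFrom f (i ∷ is) x (cs ++ cs') y

-- SearchParetoPoint f x calls y : the call on x makes the calls `calls`
-- to f (in order) and returns y.  Coordinates are processed i = 1,…,k.
SearchParetoPoint : ∀ {k} → (Point k → Bool) → Point k → List (Point k) → Point k → Set
SearchParetoPoint {k} f x cs y = SearchFrom f (allFin k) x cs y

-- Set manipulations of ParetoEnumerate (sets represented as lists)

replacements : ∀ {k} → Point k → Point k → List (Point k)
replacements {k} x y =
  concatMap (λ i → if lookup x i ℕ.≡ᵇ 0 then [] else ((y [ i ]≔ (lookup x i ∸ 1)) ∷ []))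
            (allFin k)

newS' : ∀ {k} → Point k → List (Point k) → List (Point k)
newS' x S = concatMap (λ y → if x ≤ₖᵇ y then replacements x y else (y ∷ [])) S

RemoveDominatingElements : ∀ {k} → List (Point k) → List (Point k)
RemoveDominatingElements S' =
  filterᵇ (λ x → not (any (λ y → (x ≤ₖᵇ y) ∧ not (x ≡ᵇ y)) S')) S'

remove : ∀ {k} → Point k → List (Point k) → List (Point k)
remove x S = filterᵇ (λ y → not (y ≡ᵇ x)) S

-- MainLoop f S calls : starting the while loop with the set S, some finite
-- number of complete iterations (each with an arbitrary choice of x ∈ S)
-- can be executed making exactly the calls `calls` to f, in order.
-- (`stop` allows stopping after any number of iterations, so every finite
-- sequence of complete iterations of every run is covered.)
data MainLoop {k} (f : Point k → Bool) : List (Point k) → List (Point k) → Set where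
  stop   : ∀ {S} → MainLoop f S []
  iterF  : ∀ {S x cs} → x ∈ S → f x ≡ false →
           MainLoop f (remove x S) cs →
           MainLoop f S (x ∷ cs)
  iterT  : ∀ {S x cs₁ x' cs} → x ∈ S → f x ≡ true →
           SearchParetoPoint f x cs₁ x' →
           MainLoop f (RemoveDominatingElements (newS' x' S)) cs →
           MainLoop f S (x ∷ cs₁ ++ cs)

ParetoEnumerateCalls : ∀ {k} → ℕ → (Point k → Bool) → List (Point k) → Set
ParetoEnumerateCalls {k} N f cs = MainLoop f (replicate k N ∷ []) cs

module Submission where

-- Call a list of calls to f *fresh* relative to a region R of
-- points if every call lies outside R and outside the up-sets of the earlier
-- calls in the list that returned true.  Lemma 4 follows once the calls of
-- every run are shown to be fresh relative to the empty region.  This holds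
-- for any f:
--   * a bisection step probes a point w strictly below the current candidate
--     V in one coordinate, so w ≤ V but not V ≤ w;
--   * hence SearchParetoPoint, started at a point outside an up-closed region
--     R, makes fresh calls and ends with everything excluded so far
--     contained in R ∪ ↑x', where x' is the returned Pareto point;
--   * the main loop keeps the candidate set S disjoint from an up-closed
--     region containing all excluded points, because the new candidates lie
--     below old ones and are not above x'.

open import Defs
open import Data.Bool using (Bool; true; false; if_then_else_)
open import Data.Nat using (ℕ; zero; suc; _+_; _∸_; _≤_; _<_; ⌊_/2⌋; z≤n; s≤s)
import Data.Nat as ℕ
open import Data.Nat.Properties
  using (≤-refl; ≤-trans; n≤1+n; ≤-reflexive; <⇒≤; <⇒≱; n≮n; m≤m+n; +-monoʳ-≤; +-suc; m+[n∸m]≡n; m∸n≢0⇒n<m; ⌊n/2⌋<n)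
open import Data.Fin using (Fin)
open import Data.List using (List; []; _∷_; _++_; foldl; allFin; filterᵇ)
open import Data.List.Properties using (foldl-++)
open import Data.List.Relation.Unary.Any using (here; there; satisfied)
open import Data.List.Membership.Propositional using (_∈_)
open import Data.List.Membership.Propositional.Properties using (∈-++⁻; ∈-concatMap⁻; ∈-filter⁻)
open import Data.Vec using (lookup; _[_]≔_; _∷_)
open import Data.Vec.Properties using ([]≔-idempotent; []≔-lookup; lookup∘update)
open import Data.Vec.Relation.Binary.Pointwise.Inductive as Pointwise using (decidable; _∷_)
open import Data.Product using (∃-syntax; _×_; _,_; proj₁; proj₂)
open import Data.Sum using (inj₁; inj₂; [_,_]′)
import Data.Sum as Sum
open import Data.Empty using (⊥-elim)
open import Function using (id; _∘_)
open import Level using (0ℓ)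
open import Relation.Nullary using (¬_; Dec; does; yes; no)
open import Relation.Unary using (Pred; ∅; _∪_; _⊆_)
open import Relation.Binary.PropositionalEquality using (_≡_; refl; sym; trans; cong; subst)

≤ₖ-trans : ∀ {k} {a b c : Point k} → a ≤ₖ b → b ≤ₖ c → a ≤ₖ c
≤ₖ-trans = Pointwise.trans ≤-trans

update-mono : ∀ {k} (v : Point k) (i : Fin k) {a b : ℕ} → a ≤ b → (v [ i ]≔ a) ≤ₖ (v [ i ]≔ b)
update-mono (_ ∷ v) Fin.zero    a≤b = a≤b ∷ Pointwise.refl ≤-refl
update-mono (_ ∷ v) (Fin.suc i) a≤b = ≤-refl ∷ update-mono v i a≤b

update-below : ∀ {k} (v : Point k) (i : Fin k) {a : ℕ} → a ≤ lookup v i → (v [ i ]≔ a) ≤ₖ v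
update-below v i {a} a≤vᵢ = subst ((v [ i ]≔ a) ≤ₖ_) ([]≔-lookup v i) (update-mono v i a≤vᵢ)

below-update : ∀ {k} {x v : Point k} (i : Fin k) {a : ℕ} → x ≤ₖ (v [ i ]≔ a) → lookup x i ≤ a
below-update {v = v} i {a} x≤ = ≤-trans (Pointwise.lookup x≤ i) (≤-reflexive (lookup∘update i v a))

probe : ℕ → ℕ → ℕ
probe mn mx = mn + ⌊ mx ∸ mn ∸ 1 /2⌋

probe-inside : ∀ mn mx → 1 < mx ∸ mn → suc (suc (probe mn mx)) ≤ mx
probe-inside mn mx 1<d =
  subst (suc (suc (probe mn mx)) ≤_) (m+[n∸m]≡n mn≤mx) (half-inside (mx ∸ mn) 1<d)
  where
  mn≤mx : mn ≤ mx
  mn≤mx = <⇒≤ (m∸n≢0⇒n<m {mx} {mn} (λ d≡0 → <⇒≱ 1<d (≤-trans (≤-reflexive d≡0) z≤n)))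
  half-inside : ∀ d → 1 < d → suc (suc (mn + ⌊ d ∸ 1 /2⌋)) ≤ mn + d
  half-inside (suc zero)    (s≤s ())
  half-inside (suc (suc e)) _ with ⌊n/2⌋<n e
  ... | s≤s h≤e =
    subst (_≤ mn + suc (suc e)) (trans (+-suc mn _) (cong suc (+-suc mn _)))
          (+-monoʳ-≤ mn (s≤s (s≤s h≤e)))

interval-closed : ∀ {mn mx} → mn < mx → mx ∸ mn ≤ 1 → mx ∸ 1 ≡ mn
interval-closed {zero}   {suc zero}    _          _ = refl
interval-closed {zero}   {suc (suc _)} _          (s≤s ())
interval-closed {suc _}  {suc zero}    (s≤s ())   _
interval-closed {suc mn} {suc (suc _)} (s≤s lt)   d = cong suc (interval-closed {mn} lt d)

probe-below : ∀ {k} (v : Point k) (i : Fin k) {mn mx : ℕ} → 1 < mx ∸ mn →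
  (v [ i ]≔ probe mn mx) ≤ₖ (v [ i ]≔ (mx ∸ 1)) × ¬ ((v [ i ]≔ (mx ∸ 1)) ≤ₖ (v [ i ]≔ probe mn mx))
probe-below v i {zero}  {zero}   ()
probe-below v i {suc _} {zero}   ()
probe-below v i {mn}    {suc mx} 1<d =
  update-mono v i (<⇒≤ probe<top) ,
  λ top≤w → <⇒≱ probe<top (subst (_≤ _) (lookup∘update i v mx) (below-update i top≤w))
  where
  probe<top : probe mn (suc mx) < mx
  probe<top with probe-inside mn (suc mx) 1<d
  ... | s≤s p = p

-- The points replacing a dominated candidate y lie below y and are not
-- above the Pareto point x (they lower one coordinate below x's).
replacements-below : ∀ {k} {x y s : Point k} → x ≤ₖ y → s ∈ replacements x y → s ≤ₖ y × ¬ (x ≤ₖ s)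
replacements-below {k} {x} {y} x≤y s∈ with satisfied (∈-concatMap⁻ _ {xs = allFin k} s∈)
... | i , s∈ᵢ with lookup x i in xᵢ≡ | s∈ᵢ
... | suc n | here refl =
  update-below y i (≤-trans (n≤1+n n) (subst (_≤ lookup y i) xᵢ≡ (Pointwise.lookup x≤y i))) ,
  λ x≤s → n≮n n (subst (_≤ n) xᵢ≡ (below-update i x≤s))

contribution : ∀ {k} → Point k → Point k → List (Point k)
contribution x y = if x ≤ₖᵇ y then replacements x y else (y ∷ [])

contribution-below : ∀ {k} (x y : Point k) {s : Point k} → s ∈ contribution x y → s ≤ₖ y × ¬ (x ≤ₖ s)
contribution-below x y = by-decision (decidable ℕ._≤?_ x y)
  where
  by-decision : (x≤?y : Dec (x ≤ₖ y)) {s : Point _} →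
    s ∈ (if does x≤?y then replacements x y else (y ∷ [])) → s ≤ₖ y × ¬ (x ≤ₖ s)
  by-decision (yes x≤y) s∈         = replacements-below x≤y s∈
  by-decision (no  x≰y) (here refl) = Pointwise.refl ≤-refl , x≰y

newS'-below : ∀ {k} (x : Point k) (S : List (Point k)) {s : Point k} → s ∈ newS' x S →
  ∃[ y ] y ∈ S × s ≤ₖ y × ¬ (x ≤ₖ s)
newS'-below x (y ∷ S) s∈ with ∈-++⁻ (contribution x y) s∈
... | inj₁ s∈y = y , here refl , contribution-below x y s∈y
... | inj₂ s∈S' with newS'-below x S s∈S'
...   | z , z∈S , below = z , there z∈S , below

filterᵇ-⊆ : ∀ {A : Set} (p : A → Bool) (xs : List A) {s : A} → s ∈ filterᵇ p xs → s ∈ xs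
filterᵇ-⊆ p xs s∈ = proj₁ (∈-filter⁻ _ {xs = xs} s∈)

module Freshness {k : ℕ} (f : Point k → Bool) where

  Region : Set₁
  Region = Pred (Point k) 0ℓ

  Above : Point k → Region
  Above c z = c ≤ₖ z

  Found : Point k → Region
  Found c z = f c ≡ true × c ≤ₖ z

  found-false : ∀ {c} → f c ≡ false → Found c ⊆ ∅
  found-false fc≡false (fc≡true , _) with trans (sym fc≡false) fc≡true
  ... | ()

  UpClosed : Region → Set
  UpClosed R = ∀ {a b} → a ≤ₖ b → R a → R b

  upClosed-∪-Above : ∀ {R} (c : Point k) → UpClosed R → UpClosed (R ∪ Above c)
  upClosed-∪-Above c up a≤b = Sum.map (up a≤b) (λ c≤a → ≤ₖ-trans c≤a a≤b)

  extend : Region → List (Point k) → Region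
  extend = foldl (λ R c → R ∪ Found c)

  data Fresh (R : Region) : List (Point k) → Set₁ where
    []  : Fresh R []
    _∷_ : ∀ {c cs} → ¬ R c → Fresh (R ∪ Found c) cs → Fresh R (c ∷ cs)

  fresh-antitone : ∀ {R R' cs} → R' ⊆ R → Fresh R cs → Fresh R' cs
  fresh-antitone R'⊆R []            = []
  fresh-antitone R'⊆R (c∉R ∷ fresh) = c∉R ∘ R'⊆R ∷ fresh-antitone (Sum.map₁ R'⊆R) fresh

  fresh-++ : ∀ {R} cs₁ {cs₂} → Fresh R cs₁ → Fresh (extend R cs₁) cs₂ → Fresh R (cs₁ ++ cs₂)
  fresh-++ []        []            fresh₂ = fresh₂
  fresh-++ (_ ∷ cs₁) (c∉R ∷ fresh₁) fresh₂ = c∉R ∷ fresh-++ cs₁ fresh₁ fresh₂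

  fresh-∉ : ∀ {R cs y} → Fresh R cs → y ∈ cs → ¬ R y
  fresh-∉ (y∉R ∷ _)     (here refl) = y∉R
  fresh-∉ (_   ∷ fresh) (there y∈)  = fresh-∉ fresh y∈ ∘ inj₁

  fresh-not-above : ∀ {R} before {x after y} → Fresh R (before ++ x ∷ after) →
    f x ≡ true → y ∈ after → ¬ (x ≤ₖ y)
  fresh-not-above []            (_ ∷ fresh) fx y∈ x≤y = fresh-∉ fresh y∈ (inj₂ (fx , x≤y))
  fresh-not-above (_ ∷ before) (_ ∷ fresh) fx y∈     = fresh-not-above before fresh fx y∈

  -- Invariant of SearchParetoPoint relative to an up-closed region R of
  -- points already known to be excluded: the candidate V lies outside R and
  -- everything excluded so far (Rs) lies in R or above V.
  SearchInv : Region → Region → Point k → Set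
  SearchInv R Rs V = ¬ R V × Rs ⊆ R ∪ Above V

  probe-fresh : ∀ {R Rs V w} → UpClosed R → SearchInv R Rs V → w ≤ₖ V → ¬ (V ≤ₖ w) → ¬ Rs w
  probe-fresh up (V∉R , Rs⊆) w≤V V≰w w∈Rs = [ (λ w∈R → V∉R (up w≤V w∈R)) , V≰w ]′ (Rs⊆ w∈Rs)

  probe-true : ∀ {R Rs V w} → UpClosed R → SearchInv R Rs V → w ≤ₖ V → SearchInv R (Rs ∪ Found w) w
  probe-true up (V∉R , Rs⊆) w≤V =
    V∉R ∘ up w≤V , [ Sum.map₂ (≤ₖ-trans w≤V) ∘ Rs⊆ , inj₂ ∘ proj₂ ]′

  probe-false : ∀ {R Rs V w} → f w ≡ false → SearchInv R Rs V → SearchInv R (Rs ∪ Found w) V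
  probe-false fw (V∉R , Rs⊆) = V∉R , [ Rs⊆ , ⊥-elim ∘ found-false fw ]′

  -- The candidate depends only on the coordinates other than i of the
  -- current vector, which a bisection step does not change.
  reset : ∀ {R Rs} (v : Point k) (i : Fin k) {a b : ℕ} →
    SearchInv R Rs (v [ i ]≔ b) → SearchInv R Rs ((v [ i ]≔ a) [ i ]≔ b)
  reset v i = subst (SearchInv _ _) (sym ([]≔-idempotent v i))

  unreset : ∀ {R Rs} (v : Point k) (i : Fin k) {a b : ℕ} →
    SearchInv R Rs ((v [ i ]≔ a) [ i ]≔ b) → SearchInv R Rs (v [ i ]≔ b)
  unreset v i = subst (SearchInv _ _) ([]≔-idempotent v i)

  bisection : ∀ {R} → UpClosed R → ∀ {i v mn mx cs r} → BinSearch f i v mn mx cs r → mn < mx →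
    ∀ {Rs} → SearchInv R Rs (v [ i ]≔ (mx ∸ 1)) → Fresh Rs cs × SearchInv R (extend Rs cs) (v [ i ]≔ r)
  bisection up {i} {v} (done d≤1) mn<mx inv =
    [] , subst (λ a → SearchInv _ _ (v [ i ]≔ a)) (interval-closed mn<mx d≤1) inv
  bisection up {i} {v} {mn} {mx} (stepT 1<d _ rest) _ inv
    with probe-below v i {mn} {mx} 1<d
  ... | w≤V , V≰w with bisection up rest (s≤s (m≤m+n mn _)) (reset v i (probe-true up inv w≤V))
  ...   | fresh , inv' = probe-fresh up inv w≤V V≰w ∷ fresh , unreset v i inv'
  bisection up {i} {v} {mn} {mx} (stepF 1<d fw rest) _ inv
    with probe-below v i {mn} {mx} 1<d
  ... | w≤V , V≰w with bisection up rest (probe-inside mn mx 1<d) (reset v i (probe-false fw inv))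
  ...   | fresh , inv' = probe-fresh up inv w≤V V≰w ∷ fresh , unreset v i inv'

  search : ∀ {R} → UpClosed R → ∀ {is v cs y} → SearchFrom f is v cs y →
    ∀ {Rs} → SearchInv R Rs v → Fresh Rs cs × SearchInv R (extend Rs cs) y
  search up nil inv = [] , inv
  search up {v = v} (cons {i = i} {cs = cs₁} {cs' = cs₂} bs rest) {Rs} inv
    with bisection up bs (s≤s z≤n) (subst (SearchInv _ _) (sym ([]≔-lookup v i)) inv)
  ... | fresh₁ , inv₁ with search up rest inv₁
  ...   | fresh₂ , inv₂ =
    fresh-++ cs₁ fresh₁ fresh₂ , subst (λ Q → SearchInv _ Q _) (sym (foldl-++ _ Rs cs₁ cs₂)) inv₂

  mainLoop-fresh : ∀ {S cs} → MainLoop f S cs → ∀ {R} → UpClosed R →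
    (∀ {s} → s ∈ S → ¬ R s) → Fresh R cs
  mainLoop-fresh stop up S∩R=∅ = []
  mainLoop-fresh {S} (iterF x∈S fx rest) up S∩R=∅ =
    S∩R=∅ x∈S ∷ fresh-antitone [ id , ⊥-elim ∘ found-false fx ]′
                  (mainLoop-fresh rest up (S∩R=∅ ∘ filterᵇ-⊆ _ S))
  mainLoop-fresh {S} (iterT {cs₁ = cs₁} {x' = x'} x∈S _ sp rest) {R} up S∩R=∅
    with search up sp (S∩R=∅ x∈S , Sum.map₂ proj₂)
  ... | fresh₁ , _ , covered =
    S∩R=∅ x∈S ∷ fresh-++ cs₁ fresh₁
      (fresh-antitone covered (mainLoop-fresh rest (upClosed-∪-Above x' up) S'∩R'=∅))
    where
    S'∩R'=∅ : ∀ {s} → s ∈ RemoveDominatingElements (newS' x' S) → ¬ (R ∪ Above x') s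
    S'∩R'=∅ s∈ with newS'-below x' S (filterᵇ-⊆ _ (newS' x' S) s∈)
    ... | y , y∈S , s≤y , x'≰s = [ S∩R=∅ y∈S ∘ up s≤y , x'≰s ]′

open Freshness using (Fresh; fresh-not-above; mainLoop-fresh)

lemma4 : (N k : ℕ) → 1 ≤ k → (f : Point k → Bool) → Feasibility N f →
    (calls : List (Point k)) → ParetoEnumerateCalls N f calls →
    (before : List (Point k)) (x : Point k) (after : List (Point k)) →
    calls ≡ before ++ x ∷ after → f x ≡ true →
    (y : Point k) → y ∈ after → ¬ (x ≤ₖ y)
lemma4 N k _ f _ calls run before x after calls≡ fx y y∈after =
  fresh-not-above f before (subst (Fresh f ∅) calls≡ runFresh) fx y∈after
  where
  runFresh : Fresh f ∅ calls
  runFresh = mainLoop-fresh f run (λ _ ()) (λ _ ())
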